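{- Let $\eta\in(0,1)$ and let $2\le s\le t$ be integers. Let $N\ge1$ and suppose $A\subseteq[N]=\{1,\dots,N\}$ satisfies $E_s(1_A,1_{ -A})\le (t+\eta)|A|^s$. For $a_1,\dots,a_s\in A$ let \[ r_A(a_1,\dots,a_s)=\#\{(a_1',\dots,a_s')\in A^s:\ a_1-a_1'=a_2-a_2'=\cdots=a_s-a_s'\neq 0\}. \] Then \[ \#\{(a_1,\dots,a_s)\in A^s:\ r_A(a_1,\dots,a_s)>t-1\}\le\Big(1-\frac{1-\eta}{t}\Big)|A|^s. \]
   Context: For finitely supported $f,g:\mathbb{Z}\to\mathbb{R}$, $(f*g)(x)=\sum_{y}f(y)g(x-y)$ and $E_s(f,g)=\sum_{n\in\mathbb{Z}}((f*g)(n))^s$; $1_A$, $1_{ -A}$ are the indicator functions of $A$ and $-A=\{ -a:a\in A\}$.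
   Formalization: The parameter η ranges over the rationals in (0,1). -}

module Defs where

open import Data.Nat as ℕ using (ℕ; zero; suc)
open import Data.Integer as ℤ using (ℤ; +_)
open import Data.Rational as ℚ using (ℚ)
open import Data.Bool using (Bool; true; false; not; _∧_; if_then_else_)
open import Data.List as List using (List; []; _∷_; map; concatMap; filter; length; upTo)
open import Data.Nat.ListAction using (sum)
open import Data.List.Membership.DecPropositional ℤ._≟_ using (_∈?_)
open import Data.Vec as Vec using (Vec; []; _∷_)
open import Relation.Nullary.Decidable using (⌊_⌋; does)

InRange : ℕ → ℕ → Set
InRange N a = 1 ℕ.≤ a × a ℕ.≤ N
  where open import Data.Product using (_×_)

toℚ : ℕ → ℚ
toℚ n = (+ n) ℚ./ 1

-- 1/n as a rational (only used for n ≥ 2; 1/0 := 0 by convention)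
invℕ : ℕ → ℚ
invℕ zero = ℚ.0ℚ
invℕ (suc n) = (+ 1) ℚ./ suc n

ind : List ℤ → ℤ → ℕ
ind A x = if does (x ∈? A) then 1 else 0

negSet : List ℤ → List ℤ
negSet A = map ℤ.-_ A

window : ℕ → List ℤ
window M = map (λ k → (+ k) ℤ.- (+ M)) (upTo (suc (M ℕ.+ M)))

-- convolution (f * g)(x) = Σ_y f(y) g(x - y), the sum taken over a list S of
-- integers containing the support of f
conv : List ℤ → (ℤ → ℕ) → (ℤ → ℕ) → ℤ → ℕ
conv S f g x = sum (map (λ y → f y ℕ.* g (x ℤ.- y)) S)

Aℤ : List ℕ → List ℤ
Aℤ A = map +_ A

-- E_s(1_A, 1_{-A}) = Σ_n ((1_A * 1_{-A})(n))^s for A ⊆ [N];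
-- all supports lie in the window {-2N, …, 2N}
Es : ℕ → ℕ → List ℕ → ℕ
Es N s A =
  sum (map (λ n → conv (window (N ℕ.+ N)) (ind (Aℤ A)) (ind (negSet (Aℤ A))) n ℕ.^ s)
           (window (N ℕ.+ N)))

tuples : (s : ℕ) → List ℕ → List (Vec ℕ s)
tuples zero A = [] ∷ []
tuples (suc s) A = concatMap (λ a → map (a ∷_) (tuples s A)) A

diffs : ∀ {s} → Vec ℕ s → Vec ℕ s → Vec ℤ s
diffs a a' = Vec.zipWith (λ x y → (+ x) ℤ.- (+ y)) a a'

allEqNonzero : ∀ {s} → Vec ℤ s → Bool
allEqNonzero [] = false
allEqNonzero (d ∷ ds) = not ⌊ d ℤ.≟ + 0 ⌋ ∧ Vec.foldr _ (λ e b → ⌊ e ℤ.≟ d ⌋ ∧ b) true ds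

rA : ∀ {s} → List ℕ → Vec ℕ s → ℕ
rA {s} A a = length (filter (λ a' → allEqNonzero (diffs a a') Data.Bool.≟ true) (tuples s A))
  where import Data.Bool

countHigh : ℕ → ℕ → List ℕ → ℕ
countHigh s t A = length (filter (λ a → (t ℕ.∸ 1) ℕ.<? rA A a) (tuples s A))

-- Each a with r_A(a) ≥ t contributes at least t to Σ_a r_A(a) (Markov). A tuple a′ is counted
-- in r_A(a) exactly when a − a′ is a constant vector (d, …, d) with d ≠ 0, so
-- Σ_a r_A(a) = Σ_{d ≠ 0} r(d)^s where r(d) = #{(x, y) ∈ A² : x − y = d} = (1_A * 1_{-A})(d).
-- The remaining term d = 0 of E_s is r(0)^s = |A|^s, hence
-- |A|^s + t · #{a : r_A(a) ≥ t} ≤ E_s ≤ (t + η) |A|^s, which rearranges to the claim.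

module Submission where

open import Defs
open import Data.Nat as ℕ using (ℕ)
open import Data.Rational as ℚ using (ℚ)
open import Data.List using (List; length)
open import Data.List.Relation.Unary.All using (All)
open import Data.List.Relation.Unary.Unique.Propositional using (Unique)

open import Level using (Level)
open import Function using (_∘_; Equivalence)
open import Data.Nat using (zero; suc; _+_; _*_; _∸_; _^_; _≤_; _<_; z≤n; s≤s)
open import Data.Nat.Properties
open import Data.Nat.ListAction using (sum)
open import Data.Nat.ListAction.Properties using (sum-++)
open import Data.Integer as ℤ using (ℤ; +_; 0ℤ; -_; _-_)
import Data.Integer.Properties as ℤ
import Data.Rational.Properties as ℚ
open import Data.Rational.Solver using (module +-*-Solver)
import Data.Rational.Unnormalised as ℚᵘ
import Data.Rational.Unnormalised.Properties as ℚᵘ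
open import Data.Integer.Tactic.RingSolver using (solve-∀)
open import Data.Bool using (true; false; T; _∧_; if_then_else_)
import Data.Bool as Bool
open import Data.Bool.Properties using (T-≡; T-∧)
open import Data.List using ([]; _∷_; _++_; map; concatMap; filter)
open import Data.List.Properties using (map-++; map-∘; length-map)
open import Data.List.Membership.Propositional using (_∈_)
open import Data.List.Membership.Propositional.Properties using (∈-map⁺; ∈-upTo⁺; ∈-filter⁺)
open import Data.List.Relation.Unary.Any using (here; there)
open import Data.List.Relation.Unary.All as All using ([]; _∷_)
import Data.List.Relation.Unary.All.Properties as All
open import Data.List.Relation.Unary.AllPairs using (_∷_)
import Data.List.Relation.Unary.Unique.Propositional.Properties as Unique
open import Data.Vec as Vec using (Vec; []; _∷_)
import Data.Vec.Relation.Unary.All as VecAll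
open import Data.Product using (_×_; _,_)
open import Relation.Nullary using (Dec; yes; no; _because_; ¬_; does; invert; contradiction)
open import Relation.Nullary.Decidable using (⌊_⌋; dec-true; dec-false; toWitness; toWitnessFalse)
open import Relation.Unary using (Pred; Decidable)
open import Relation.Unary.Properties using (∁?)
open import Relation.Binary.Definitions using (DecidableEquality)
open import Relation.Binary.PropositionalEquality
open import Algebra.Properties.CommutativeSemigroup +-commutativeSemigroup
  using (interchange; x∙yz≈y∙xz)

private
  variable
    a p : Level
    X Y : Set a
    P Q : Set p

∑ : List X → (X → ℕ) → ℕ
∑ xs f = sum (map f xs)

syntax ∑ xs (λ x → e) = ∑[ x ∈ xs ] e

module _ {f g : X → ℕ} where

  ∑-cong : ∀ xs → (∀ x → f x ≡ g x) → ∑ xs f ≡ ∑ xs g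
  ∑-cong []       f≡g = refl
  ∑-cong (x ∷ xs) f≡g = cong₂ _+_ (f≡g x) (∑-cong xs f≡g)

  ∑-mono-∈ : ∀ xs → (∀ {x} → x ∈ xs → f x ≤ g x) → ∑ xs f ≤ ∑ xs g
  ∑-mono-∈ []       f≤g = z≤n
  ∑-mono-∈ (x ∷ xs) f≤g = +-mono-≤ (f≤g (here refl)) (∑-mono-∈ xs (f≤g ∘ there))

  ∑-mono : ∀ xs → (∀ x → f x ≤ g x) → ∑ xs f ≤ ∑ xs g
  ∑-mono xs f≤g = ∑-mono-∈ xs (λ {x} _ → f≤g x)

  ∑-+ : ∀ xs → ∑[ x ∈ xs ] (f x + g x) ≡ ∑ xs f + ∑ xs g
  ∑-+ []       = refl
  ∑-+ (x ∷ xs) = trans (cong (_+_ (f x + g x)) (∑-+ xs)) (interchange (f x) (g x) _ _)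

∑-0 : ∀ (xs : List X) → ∑[ x ∈ xs ] 0 ≡ 0
∑-0 []       = refl
∑-0 (x ∷ xs) = ∑-0 xs

∑-*ˡ : ∀ (xs : List X) c (f : X → ℕ) → ∑[ x ∈ xs ] (c * f x) ≡ c * ∑ xs f
∑-*ˡ []       c f = sym (*-zeroʳ c)
∑-*ˡ (x ∷ xs) c f = trans (cong (_+_ (c * f x)) (∑-*ˡ xs c f)) (sym (*-distribˡ-+ c (f x) _))

∑-*ʳ : ∀ (xs : List X) c (f : X → ℕ) → ∑[ x ∈ xs ] (f x * c) ≡ ∑ xs f * c
∑-*ʳ xs c f = trans (∑-cong xs (λ x → *-comm (f x) c)) (trans (∑-*ˡ xs c f) (*-comm c _))

∑-++ : ∀ (xs ys : List X) (f : X → ℕ) → ∑ (xs ++ ys) f ≡ ∑ xs f + ∑ ys f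
∑-++ xs ys f = trans (cong sum (map-++ f xs ys)) (sum-++ (map f xs) (map f ys))

∑-map : ∀ (g : X → Y) xs (f : Y → ℕ) → ∑ (map g xs) f ≡ ∑[ x ∈ xs ] f (g x)
∑-map g xs f = cong sum (sym (map-∘ xs))

∑-concatMap : ∀ (g : X → List Y) xs (f : Y → ℕ) → ∑ (concatMap g xs) f ≡ ∑[ x ∈ xs ] ∑ (g x) f
∑-concatMap g []       f = refl
∑-concatMap g (x ∷ xs) f = trans (∑-++ (g x) _ f) (cong (_+_ (∑ (g x) f)) (∑-concatMap g xs f))

∑-comm : ∀ (xs : List X) (ys : List Y) (F : X → Y → ℕ) →
         ∑[ x ∈ xs ] ∑[ y ∈ ys ] F x y ≡ ∑[ y ∈ ys ] ∑[ x ∈ xs ] F x y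
∑-comm []       ys F = sym (∑-0 ys)
∑-comm (x ∷ xs) ys F = trans (cong (_+_ (∑ ys (F x))) (∑-comm xs ys F)) (sym (∑-+ ys))

∑1≡length : ∀ (xs : List X) → ∑[ x ∈ xs ] 1 ≡ length xs
∑1≡length []       = refl
∑1≡length (x ∷ xs) = cong suc (∑1≡length xs)

∈⇒≤∑ : ∀ {x} {xs : List X} (f : X → ℕ) → x ∈ xs → f x ≤ ∑ xs f
∈⇒≤∑ {xs = y ∷ xs} f (here refl) = m≤m+n (f y) _
∈⇒≤∑ {xs = y ∷ xs} f (there x∈) = ≤-trans (∈⇒≤∑ f x∈) (m≤n+m _ (f y))

𝟙 : Dec P → ℕ
𝟙 p? = if does p? then 1 else 0

𝟙-yes : (p? : Dec P) → P → 𝟙 p? ≡ 1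
𝟙-yes p? x rewrite dec-true p? x = refl

𝟙-no : (p? : Dec P) → ¬ P → 𝟙 p? ≡ 0
𝟙-no p? ¬x rewrite dec-false p? ¬x = refl

𝟙≤ : (p? : Dec P) {n : ℕ} → (P → 1 ≤ n) → 𝟙 p? ≤ n
𝟙≤ (false because _)     P⇒1≤n = z≤n
𝟙≤ (true  because [x]) P⇒1≤n = P⇒1≤n (invert [x])

𝟙-mono : (p? : Dec P) (q? : Dec Q) → (P → Q) → 𝟙 p? ≤ 𝟙 q?
𝟙-mono p? q? P⇒Q = 𝟙≤ p? (λ x → ≤-reflexive (sym (𝟙-yes q? (P⇒Q x))))

module _ {P : Pred X p} (P? : Decidable P) where

  length-filter : ∀ xs → length (filter P? xs) ≡ ∑[ x ∈ xs ] 𝟙 (P? x)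
  length-filter []       = refl
  length-filter (x ∷ xs) with P? x
  ... | yes _ = cong suc (length-filter xs)
  ... | no  _ = length-filter xs

  ∑-partition : ∀ xs (f : X → ℕ) → ∑ xs f ≡ ∑ (filter P? xs) f + ∑ (filter (∁? P?) xs) f
  ∑-partition []       f = refl
  ∑-partition (x ∷ xs) f with P? x
  ... | yes _ = trans (cong (_+_ (f x)) (∑-partition xs f)) (sym (+-assoc (f x) _ _))
  ... | no  _ = trans (cong (_+_ (f x)) (∑-partition xs f)) (x∙yz≈y∙xz (f x) (∑ (filter P? xs) f) _)

module _ (_≟_ : DecidableEquality X) where

  open import Data.List.Membership.DecPropositional _≟_ using (_∈?_)

  ∑𝟙≟≤𝟙∈? : ∀ {xs} → Unique xs → ∀ y → ∑[ x ∈ xs ] 𝟙 (x ≟ y) ≤ 𝟙 (y ∈? xs)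
  ∑𝟙≟≤𝟙∈? {[]}     _              y = z≤n
  ∑𝟙≟≤𝟙∈? {x ∷ xs} (x≢xs ∷ uniq) y with x ≟ y
  ... | yes refl = begin
    suc (∑[ z ∈ xs ] 𝟙 (z ≟ x))  ≤⟨ s≤s (∑𝟙≟≤𝟙∈? uniq x) ⟩
    suc (𝟙 (x ∈? xs))            ≡⟨ cong suc (𝟙-no (x ∈? xs) (All.All¬⇒¬Any x≢xs)) ⟩
    1                            ≡⟨ sym (𝟙-yes (x ∈? (x ∷ xs)) (here refl)) ⟩
    𝟙 (x ∈? (x ∷ xs))            ∎
    where open ≤-Reasoning
  ... | no _ = ≤-trans (∑𝟙≟≤𝟙∈? uniq y) (𝟙-mono (y ∈? xs) (y ∈? (x ∷ xs)) there)

  ∑≤∑-𝟙∈?-* : ∀ {xs ys} → Unique xs → All (_∈ ys) xs → (h : X → ℕ) →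
              ∑ xs h ≤ ∑[ y ∈ ys ] (𝟙 (y ∈? xs) * h y)
  ∑≤∑-𝟙∈?-* {xs} {ys} uniq xs⊆ys h = begin
    ∑ xs h
      ≤⟨ ∑-mono-∈ xs (λ x∈xs → diagonal≤ (All.lookup xs⊆ys x∈xs)) ⟩
    ∑[ x ∈ xs ] ∑[ y ∈ ys ] (𝟙 (x ≟ y) * h y)
      ≡⟨ ∑-comm xs ys _ ⟩
    ∑[ y ∈ ys ] ∑[ x ∈ xs ] (𝟙 (x ≟ y) * h y)
      ≡⟨ ∑-cong ys (λ y → ∑-*ʳ xs (h y) (λ x → 𝟙 (x ≟ y))) ⟩
    ∑[ y ∈ ys ] ((∑[ x ∈ xs ] 𝟙 (x ≟ y)) * h y)
      ≤⟨ ∑-mono ys (λ y → *-monoˡ-≤ (h y) (∑𝟙≟≤𝟙∈? uniq y)) ⟩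
    ∑[ y ∈ ys ] (𝟙 (y ∈? xs) * h y) ∎
    where
      open ≤-Reasoning
      diagonal≤ : ∀ {x} → x ∈ ys → h x ≤ ∑[ y ∈ ys ] (𝟙 (x ≟ y) * h y)
      diagonal≤ {x} x∈ys = begin
        h x                    ≡⟨ *-identityˡ (h x) ⟨
        1 * h x                ≡⟨ cong (_* h x) (𝟙-yes (x ≟ x) refl) ⟨
        𝟙 (x ≟ x) * h x        ≤⟨ ∈⇒≤∑ (λ y → 𝟙 (x ≟ y) * h y) x∈ys ⟩
        ∑[ y ∈ ys ] (𝟙 (x ≟ y) * h y) ∎

-∈-window : ∀ {M x y} → x ≤ M → y ≤ M → + x - + y ∈ window M
-∈-window {M} {x} {y} x≤M y≤M =
  subst (_∈ window M) shift (∈-map⁺ (λ k → + k - + M) (∈-upTo⁺ (s≤s (+-mono-≤ x≤M (m∸n≤m M y)))))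
  where
    cancel : ∀ (i j k : ℤ) → (i ℤ.+ j) - (j ℤ.+ k) ≡ i - k
    cancel = solve-∀
    shift : + (x + (M ∸ y)) - + M ≡ + x - + y
    shift = begin
      + (x + (M ∸ y)) - + M                ≡⟨ cong (λ m → + (x + (M ∸ y)) - + m) (m∸n+n≡m y≤M) ⟨
      + (x + (M ∸ y)) - + (M ∸ y + y)      ≡⟨ cong₂ _-_ (ℤ.pos-+ x (M ∸ y)) (ℤ.pos-+ (M ∸ y) y) ⟩
      (+ x ℤ.+ + (M ∸ y)) - (+ (M ∸ y) ℤ.+ + y) ≡⟨ cancel (+ x) (+ (M ∸ y)) (+ y) ⟩
      + x - + y                            ∎
      where open ≡-Reasoning

+∈-window : ∀ {M x} → x ≤ M → + x ∈ window M
+∈-window {M} {x} x≤M = subst (_∈ window M) (ℤ.+-identityʳ (+ x)) (-∈-window x≤M z≤n)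

0∈-window : ∀ {M} → 0ℤ ∈ window M
0∈-window {M} = -∈-window {M} z≤n z≤n

diffCount : List ℤ → ℤ → ℕ
diffCount B d = ∑[ x ∈ B ] ∑[ y ∈ B ] 𝟙 (x - y ℤ.≟ d)

length≤diffCount-0 : ∀ B → length B ≤ diffCount B 0ℤ
length≤diffCount-0 B = begin
  length B      ≡⟨ ∑1≡length B ⟨
  ∑[ x ∈ B ] 1  ≤⟨ ∑-mono-∈ B diagonal ⟩
  diffCount B 0ℤ ∎
  where
    open ≤-Reasoning
    diagonal : ∀ {x} → x ∈ B → 1 ≤ ∑[ y ∈ B ] 𝟙 (x - y ℤ.≟ 0ℤ)
    diagonal {x} x∈B = ≤-trans (≤-reflexive (sym (𝟙-yes (x - x ℤ.≟ 0ℤ) (ℤ.+-inverseʳ x))))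
                               (∈⇒≤∑ (λ y → 𝟙 (x - y ℤ.≟ 0ℤ)) x∈B)

diffCount≤conv : ∀ {B S} → Unique B → All (_∈ S) B → ∀ d →
                 diffCount B d ≤ conv S (ind B) (ind (negSet B)) d
diffCount≤conv {B} {S} uniq B⊆S d = begin
  ∑[ x ∈ B ] ∑[ y ∈ B ] 𝟙 (x - y ℤ.≟ d)
    ≤⟨ ∑-mono B (λ x → ∑-mono B (λ y → 𝟙-mono (x - y ℤ.≟ d) (y ℤ.≟ x - d) (solve-for-y x y d))) ⟩
  ∑[ x ∈ B ] ∑[ y ∈ B ] 𝟙 (y ℤ.≟ x - d)
    ≤⟨ ∑-mono B (λ x → ∑𝟙≟≤𝟙∈? ℤ._≟_ uniq (x - d)) ⟩
  ∑[ x ∈ B ] 𝟙 (x - d ∈? B)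
    ≤⟨ ∑-mono B (λ x → 𝟙-mono (x - d ∈? B) (d - x ∈? negSet B) (negate x)) ⟩
  ∑[ x ∈ B ] 𝟙 (d - x ∈? negSet B)
    ≤⟨ ∑≤∑-𝟙∈?-* ℤ._≟_ uniq B⊆S (λ y → ind (negSet B) (d - y)) ⟩
  conv S (ind B) (ind (negSet B)) d ∎
  where
    open ≤-Reasoning
    open import Data.List.Membership.DecPropositional ℤ._≟_ using (_∈?_)
    y≡x-[x-y] : ∀ (x y : ℤ) → y ≡ x - (x - y)
    y≡x-[x-y] = solve-∀
    -[x-d]≡d-x : ∀ (x d : ℤ) → - (x - d) ≡ d - x
    -[x-d]≡d-x = solve-∀
    solve-for-y : ∀ x y d → x - y ≡ d → y ≡ x - d
    solve-for-y x y d refl = y≡x-[x-y] x y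
    negate : ∀ x → x - d ∈ B → d - x ∈ negSet B
    negate x x-d∈B = subst (_∈ negSet B) (-[x-d]≡d-x x d) (∈-map⁺ -_ x-d∈B)

∑-tuples-suc : ∀ s A (f : Vec ℕ (suc s) → ℕ) →
               ∑ (tuples (suc s) A) f ≡ ∑[ x ∈ A ] ∑[ xs ∈ tuples s A ] f (x ∷ xs)
∑-tuples-suc s A f = trans (∑-concatMap (λ x → map (x ∷_) (tuples s A)) A f)
                           (∑-cong A (λ x → ∑-map (x ∷_) (tuples s A) f))

tuples-All : ∀ {P : Pred ℕ p} s {A} → All P A → All (VecAll.All P) (tuples s A)
tuples-All zero    PA = VecAll.[] ∷ []
tuples-All (suc s) PA =
  All.concat⁺ (All.map⁺ (All.map (λ Px → All.map⁺ (All.map (Px VecAll.∷_) (tuples-All s PA))) PA))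

zipProduct : ∀ {s} → (X → Y → ℕ) → Vec X s → Vec Y s → ℕ
zipProduct F []       []       = 1
zipProduct F (x ∷ xs) (y ∷ ys) = F x y * zipProduct F xs ys

∑∑-zipProduct : ∀ s A (F : ℕ → ℕ → ℕ) →
                ∑[ a ∈ tuples s A ] ∑[ b ∈ tuples s A ] zipProduct F a b
                  ≡ (∑[ x ∈ A ] ∑[ y ∈ A ] F x y) ^ s
∑∑-zipProduct zero    A F = refl
∑∑-zipProduct (suc s) A F = begin
  ∑[ a ∈ Aˢ⁺ ] ∑[ b ∈ Aˢ⁺ ] zipProduct F a b
    ≡⟨ ∑-tuples-suc s A _ ⟩
  ∑[ x ∈ A ] ∑[ as ∈ Aˢ ] ∑[ b ∈ Aˢ⁺ ] zipProduct F (x ∷ as) b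
    ≡⟨ ∑-cong A (λ x → ∑-cong Aˢ (λ as → ∑-tuples-suc s A _)) ⟩
  ∑[ x ∈ A ] ∑[ as ∈ Aˢ ] ∑[ y ∈ A ] ∑[ bs ∈ Aˢ ] (F x y * zipProduct F as bs)
    ≡⟨ ∑-cong A (λ x → ∑-cong Aˢ (λ as → ∑-cong A (λ y → ∑-*ˡ Aˢ (F x y) (zipProduct F as)))) ⟩
  ∑[ x ∈ A ] ∑[ as ∈ Aˢ ] ∑[ y ∈ A ] (F x y * Z as)
    ≡⟨ ∑-cong A (λ x → ∑-comm Aˢ A _) ⟩
  ∑[ x ∈ A ] ∑[ y ∈ A ] ∑[ as ∈ Aˢ ] (F x y * Z as)
    ≡⟨ ∑-cong A (λ x → ∑-cong A (λ y → ∑-*ˡ Aˢ (F x y) Z)) ⟩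
  ∑[ x ∈ A ] ∑[ y ∈ A ] (F x y * ∑ Aˢ Z)
    ≡⟨ ∑-cong A (λ x → ∑-*ʳ A (∑ Aˢ Z) (F x)) ⟩
  ∑[ x ∈ A ] ((∑[ y ∈ A ] F x y) * ∑ Aˢ Z)
    ≡⟨ ∑-*ʳ A (∑ Aˢ Z) _ ⟩
  (∑[ x ∈ A ] ∑[ y ∈ A ] F x y) * ∑ Aˢ Z
    ≡⟨ cong (_*_ (∑[ x ∈ A ] ∑[ y ∈ A ] F x y)) (∑∑-zipProduct s A F) ⟩
  (∑[ x ∈ A ] ∑[ y ∈ A ] F x y) ^ suc s ∎
  where
    open ≡-Reasoning
    Aˢ  = tuples s A
    Aˢ⁺ = tuples (suc s) A
    Z : Vec ℕ s → ℕ
    Z as = ∑[ bs ∈ Aˢ ] zipProduct F as bs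

hasDiff : ℤ → ℕ → ℕ → ℕ
hasDiff d x y = 𝟙 (+ x - + y ℤ.≟ d)

∑∑hasDiff≡diffCount : ∀ A d → ∑[ x ∈ A ] ∑[ y ∈ A ] hasDiff d x y ≡ diffCount (Aℤ A) d
∑∑hasDiff≡diffCount A d =
  sym (trans (∑-map +_ A _) (∑-cong A (λ x → ∑-map +_ A (λ y → 𝟙 (+ x - y ℤ.≟ d)))))

allEqNonzero-∷ : ∀ {s} d (ds : Vec ℤ s) → allEqNonzero (d ∷ ds) ≡ true →
                 d ≢ 0ℤ × VecAll.All (_≡ d) ds
allEqNonzero-∷ d ds eq with Equivalence.to T-∧ (Equivalence.from T-≡ eq)
... | d≢0 , restEq = toWitnessFalse d≢0 , allEq ds restEq
  where
    allEq : ∀ {s} (es : Vec ℤ s) → T (Vec.foldr _ (λ e b → ⌊ e ℤ.≟ d ⌋ ∧ b) true es) →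
            VecAll.All (_≡ d) es
    allEq []       _ = VecAll.[]
    allEq (e ∷ es) t with Equivalence.to T-∧ t
    ... | e≡d , rest = toWitness e≡d VecAll.∷ allEq es rest

zipProduct-hasDiff : ∀ {s} d (a b : Vec ℕ s) → VecAll.All (_≡ d) (diffs a b) →
                     zipProduct (hasDiff d) a b ≡ 1
zipProduct-hasDiff d []      []      VecAll.[]          = refl
zipProduct-hasDiff d (x ∷ a) (y ∷ b) (x-y≡d VecAll.∷ eqs) =
  cong₂ _*_ (𝟙-yes (+ x - + y ℤ.≟ d) x-y≡d) (zipProduct-hasDiff d a b eqs)

nonzeroWindow : ℕ → List ℤ
nonzeroWindow M = filter (∁? (ℤ._≟ 0ℤ)) (window M)

𝟙allEqNonzero≤∑zipProduct : ∀ {N s} {a b : Vec ℕ s} →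
  VecAll.All (InRange N) a → VecAll.All (InRange N) b →
  𝟙 (allEqNonzero (diffs a b) Bool.≟ true)
    ≤ ∑[ d ∈ nonzeroWindow (N + N) ] zipProduct (hasDiff d) a b
𝟙allEqNonzero≤∑zipProduct {a = []} {[]} _ _ = 𝟙≤ (false Bool.≟ true) (λ ())
𝟙allEqNonzero≤∑zipProduct {N} {a = x ∷ a} {y ∷ b} ((_ , x≤N) VecAll.∷ _) ((_ , y≤N) VecAll.∷ _) =
  𝟙≤ (allEqNonzero (diffs (x ∷ a) (y ∷ b)) Bool.≟ true) λ allEq →
    let d≢0 , restEq = allEqNonzero-∷ (+ x - + y) (diffs a b) allEq
        d∈W = ∈-filter⁺ (∁? (ℤ._≟ 0ℤ)) (-∈-window (≤-trans x≤N (m≤m+n N N)) (≤-trans y≤N (m≤m+n N N))) d≢0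
    in begin
      1                                   ≡⟨ zipProduct-hasDiff (+ x - + y) (x ∷ a) (y ∷ b) (refl VecAll.∷ restEq) ⟨
      zipProduct (hasDiff (+ x - + y)) (x ∷ a) (y ∷ b)
                                          ≤⟨ ∈⇒≤∑ (λ d → zipProduct (hasDiff d) (x ∷ a) (y ∷ b)) d∈W ⟩
      ∑[ d ∈ nonzeroWindow (N + N) ] zipProduct (hasDiff d) (x ∷ a) (y ∷ b) ∎
  where open ≤-Reasoning

∑rA≤∑diffCount^s : ∀ {N} s {A} → All (InRange N) A →
                   ∑[ a ∈ tuples s A ] rA A a ≤ ∑[ d ∈ nonzeroWindow (N + N) ] (diffCount (Aℤ A) d ^ s)
∑rA≤∑diffCount^s {N} s {A} A⊆[N] = begin
  ∑[ a ∈ Aˢ ] rA A a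
    ≡⟨ ∑-cong Aˢ (λ a → length-filter _ Aˢ) ⟩
  ∑[ a ∈ Aˢ ] ∑[ b ∈ Aˢ ] 𝟙 (allEqNonzero (diffs a b) Bool.≟ true)
    ≤⟨ ∑-mono-∈ Aˢ (λ a∈Aˢ → ∑-mono-∈ Aˢ (λ b∈Aˢ →
         𝟙allEqNonzero≤∑zipProduct (All.lookup Aˢ⊆[N]ˢ a∈Aˢ) (All.lookup Aˢ⊆[N]ˢ b∈Aˢ))) ⟩
  ∑[ a ∈ Aˢ ] ∑[ b ∈ Aˢ ] ∑[ d ∈ W ] zipProduct (hasDiff d) a b
    ≡⟨ ∑-cong Aˢ (λ a → ∑-comm Aˢ W _) ⟩
  ∑[ a ∈ Aˢ ] ∑[ d ∈ W ] ∑[ b ∈ Aˢ ] zipProduct (hasDiff d) a b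
    ≡⟨ ∑-comm Aˢ W _ ⟩
  ∑[ d ∈ W ] ∑[ a ∈ Aˢ ] ∑[ b ∈ Aˢ ] zipProduct (hasDiff d) a b
    ≡⟨ ∑-cong W (λ d → trans (∑∑-zipProduct s A (hasDiff d)) (cong (_^ s) (∑∑hasDiff≡diffCount A d))) ⟩
  ∑[ d ∈ W ] (diffCount (Aℤ A) d ^ s) ∎
  where
    open ≤-Reasoning
    Aˢ = tuples s A
    W = nonzeroWindow (N + N)
    Aˢ⊆[N]ˢ = tuples-All s A⊆[N]

markov : ∀ t (xs : List X) (f : X → ℕ) → t * length (filter (λ x → t ∸ 1 ℕ.<? f x) xs) ≤ ∑ xs f
markov t xs f = begin
  t * length (filter P? xs)      ≡⟨ cong (t *_) (length-filter P? xs) ⟩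
  t * ∑[ x ∈ xs ] 𝟙 (P? x)       ≡⟨ ∑-*ˡ xs t (𝟙 ∘ P?) ⟨
  ∑[ x ∈ xs ] (t * 𝟙 (P? x))     ≤⟨ ∑-mono xs (λ x → t*𝟙≤ (f x) (P? x)) ⟩
  ∑ xs f                         ∎
  where
    open ≤-Reasoning
    P? = λ x → t ∸ 1 ℕ.<? f x
    t*𝟙≤ : ∀ n (t-1<n? : Dec (t ∸ 1 < n)) → t * 𝟙 t-1<n? ≤ n
    t*𝟙≤ n (yes t-1<n) = ≤-trans (≤-reflexive (*-identityʳ t)) (≤-trans (m≤n+m∸n t 1) t-1<n)
    t*𝟙≤ n (no _)      = ≤-trans (≤-reflexive (*-zeroʳ t)) z≤n

length^s+t*countHigh≤Es : ∀ {N} s t {A} → Unique A → All (InRange N) A →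
          length A ^ s + t * countHigh s t A ≤ Es N s A
length^s+t*countHigh≤Es {N} s t {A} uniq A⊆[N] = begin
  length A ^ s + t * countHigh s t A
    ≤⟨ +-mono-≤ (^-monoˡ-≤ s |A|≤r₀) (markov t (tuples s A) (rA A)) ⟩
  diffCount B 0ℤ ^ s + ∑[ a ∈ tuples s A ] rA A a
    ≤⟨ +-monoʳ-≤ (diffCount B 0ℤ ^ s) (∑rA≤∑diffCount^s s A⊆[N]) ⟩
  diffCount B 0ℤ ^ s + ∑[ d ∈ nonzeroWindow (N + N) ] (diffCount B d ^ s)
    ≤⟨ +-mono-≤ (^-monoˡ-≤ s (r≤conv 0ℤ)) (∑-mono (nonzeroWindow (N + N)) (λ d → ^-monoˡ-≤ s (r≤conv d))) ⟩
  E 0ℤ + ∑ (nonzeroWindow (N + N)) E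
    ≤⟨ +-monoˡ-≤ _ (∈⇒≤∑ E (∈-filter⁺ (ℤ._≟ 0ℤ) (0∈-window {N + N}) refl)) ⟩
  ∑ (filter (ℤ._≟ 0ℤ) W) E + ∑ (nonzeroWindow (N + N)) E
    ≡⟨ ∑-partition (ℤ._≟ 0ℤ) W E ⟨
  Es N s A ∎
  where
    open ≤-Reasoning
    B = Aℤ A
    W = window (N + N)
    E : ℤ → ℕ
    E d = conv W (ind B) (ind (negSet B)) d ^ s
    r≤conv : ∀ d → diffCount B d ≤ conv W (ind B) (ind (negSet B)) d
    r≤conv = diffCount≤conv (Unique.map⁺ ℤ.+-injective uniq)
                            (All.map⁺ (All.map (λ (_ , x≤N) → +∈-window (≤-trans x≤N (m≤m+n N N))) A⊆[N]))
    |A|≤r₀ : length A ≤ diffCount B 0ℤ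
    |A|≤r₀ = ≤-trans (≤-reflexive (sym (length-map +_ A))) (length≤diffCount-0 B)

toℚᵘ-toℚ : ∀ n → ℚ.toℚᵘ (toℚ n) ℚᵘ.≃ ℚᵘ.mkℚᵘ (+ n) 0
toℚᵘ-toℚ n = ℚ.toℚᵘ-fromℚᵘ (ℚᵘ.mkℚᵘ (+ n) 0)

toℚ-+ : ∀ m n → toℚ (m + n) ≡ toℚ m ℚ.+ toℚ n
toℚ-+ m n = ℚ.toℚᵘ-injective (begin
  ℚ.toℚᵘ (toℚ (m + n))                      ≈⟨ toℚᵘ-toℚ (m + n) ⟩
  ℚᵘ.mkℚᵘ (+ (m + n)) 0                     ≈⟨ ℚᵘ.*≡* (trans (cong (ℤ._* + 1) (ℤ.pos-+ m n)) (over1 (+ m) (+ n))) ⟩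
  ℚᵘ.mkℚᵘ (+ m) 0 ℚᵘ.+ ℚᵘ.mkℚᵘ (+ n) 0       ≈⟨ ℚᵘ.+-cong (toℚᵘ-toℚ m) (toℚᵘ-toℚ n) ⟨
  ℚ.toℚᵘ (toℚ m) ℚᵘ.+ ℚ.toℚᵘ (toℚ n)        ≈⟨ ℚ.toℚᵘ-homo-+ (toℚ m) (toℚ n) ⟨
  ℚ.toℚᵘ (toℚ m ℚ.+ toℚ n)                  ∎)
  where
    open ℚᵘ.≃-Reasoning
    over1 : ∀ i j → (i ℤ.+ j) ℤ.* + 1 ≡ (i ℤ.* + 1 ℤ.+ j ℤ.* + 1) ℤ.* + 1
    over1 = solve-∀

toℚ-* : ∀ m n → toℚ (m * n) ≡ toℚ m ℚ.* toℚ n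
toℚ-* m n = ℚ.toℚᵘ-injective (begin
  ℚ.toℚᵘ (toℚ (m * n))                      ≈⟨ toℚᵘ-toℚ (m * n) ⟩
  ℚᵘ.mkℚᵘ (+ (m * n)) 0                     ≈⟨ ℚᵘ.*≡* (cong (ℤ._* + 1) (ℤ.pos-* m n)) ⟩
  ℚᵘ.mkℚᵘ (+ m) 0 ℚᵘ.* ℚᵘ.mkℚᵘ (+ n) 0       ≈⟨ ℚᵘ.*-cong (toℚᵘ-toℚ m) (toℚᵘ-toℚ n) ⟨
  ℚ.toℚᵘ (toℚ m) ℚᵘ.* ℚ.toℚᵘ (toℚ n)        ≈⟨ ℚ.toℚᵘ-homo-* (toℚ m) (toℚ n) ⟨
  ℚ.toℚᵘ (toℚ m ℚ.* toℚ n)                  ∎)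
  where open ℚᵘ.≃-Reasoning

toℚ-mono-≤ : ∀ {m n} → m ≤ n → toℚ m ℚ.≤ toℚ n
toℚ-mono-≤ {m} {n} m≤n = ℚ.toℚᵘ-cancel-≤ (begin
  ℚ.toℚᵘ (toℚ m)         ≃⟨ toℚᵘ-toℚ m ⟩
  ℚᵘ.mkℚᵘ (+ m) 0        ≤⟨ ℚᵘ.*≤* (ℤ.*-monoʳ-≤-nonNeg (+ 1) (ℤ.+≤+ m≤n)) ⟩
  ℚᵘ.mkℚᵘ (+ n) 0        ≃⟨ toℚᵘ-toℚ n ⟨
  ℚ.toℚᵘ (toℚ n)         ∎)
  where open ℚᵘ.≤-Reasoning

invℕ-inverseˡ : ∀ n → invℕ (suc n) ℚ.* toℚ (suc n) ≡ ℚ.1ℚ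
invℕ-inverseˡ n = ℚ.toℚᵘ-injective (begin
  ℚ.toℚᵘ (invℕ (suc n) ℚ.* toℚ (suc n))
    ≈⟨ ℚ.toℚᵘ-homo-* (invℕ (suc n)) (toℚ (suc n)) ⟩
  ℚ.toℚᵘ (invℕ (suc n)) ℚᵘ.* ℚ.toℚᵘ (toℚ (suc n))
    ≈⟨ ℚᵘ.*-cong (ℚ.toℚᵘ-fromℚᵘ (ℚᵘ.mkℚᵘ (+ 1) n)) (toℚᵘ-toℚ (suc n)) ⟩
  ℚᵘ.mkℚᵘ (+ 1) n ℚᵘ.* ℚᵘ.mkℚᵘ (+ suc n) 0
    ≈⟨ ℚᵘ.*-inverseˡ (ℚᵘ.mkℚᵘ (+ suc n) 0) ⟩
  ℚ.toℚᵘ ℚ.1ℚ ∎)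
  where open ℚᵘ.≃-Reasoning

ℕ-bound⇒ℚ-bound : ∀ (η : ℚ) t c L E → L + suc t * c ≤ E →
                  toℚ E ℚ.≤ (toℚ (suc t) ℚ.+ η) ℚ.* toℚ L →
                  toℚ c ℚ.≤ (ℚ.1ℚ ℚ.- (ℚ.1ℚ ℚ.- η) ℚ.* invℕ (suc t)) ℚ.* toℚ L
ℕ-bound⇒ℚ-bound η t c L E L+tc≤E E≤[t+η]L = begin
  cℚ                                   ≡⟨ ℚ.*-identityˡ cℚ ⟨
  ℚ.1ℚ ℚ.* cℚ                          ≡⟨ cong (ℚ._* cℚ) (invℕ-inverseˡ t) ⟨
  (i ℚ.* tℚ) ℚ.* cℚ                    ≡⟨ ℚ.*-assoc i tℚ cℚ ⟩
  i ℚ.* (tℚ ℚ.* cℚ)                    ≤⟨ ℚ.*-monoˡ-≤-nonNeg i tc≤[t+η-1]L ⟩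
  i ℚ.* ((tℚ ℚ.+ η ℚ.- ℚ.1ℚ) ℚ.* Lℚ)   ≡⟨ expand i tℚ η Lℚ ⟩
  (i ℚ.* tℚ) ℚ.* Lℚ ℚ.- (ℚ.1ℚ ℚ.- η) ℚ.* i ℚ.* Lℚ
    ≡⟨ cong (λ u → u ℚ.* Lℚ ℚ.- (ℚ.1ℚ ℚ.- η) ℚ.* i ℚ.* Lℚ) (invℕ-inverseˡ t) ⟩
  ℚ.1ℚ ℚ.* Lℚ ℚ.- (ℚ.1ℚ ℚ.- η) ℚ.* i ℚ.* Lℚ
    ≡⟨ collect i η Lℚ ⟩
  (ℚ.1ℚ ℚ.- (ℚ.1ℚ ℚ.- η) ℚ.* i) ℚ.* Lℚ ∎
  where
    open ℚ.≤-Reasoning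
    open +-*-Solver
    i = invℕ (suc t)
    tℚ = toℚ (suc t)
    cℚ = toℚ c
    Lℚ = toℚ L
    instance
      i≥0 : ℚ.NonNegative i
      i≥0 = ℚ.normalize-nonNeg 1 (suc t)
    cancel : ∀ l x → x ≡ l ℚ.+ x ℚ.- l
    cancel = solve 2 (λ l x → x := l :+ x :- l) refl
    factor : ∀ t e l → (t ℚ.+ e) ℚ.* l ℚ.- l ≡ (t ℚ.+ e ℚ.- ℚ.1ℚ) ℚ.* l
    factor = solve 3 (λ t e l → (t :+ e) :* l :- l := (t :+ e :- con ℚ.1ℚ) :* l) refl
    expand : ∀ i t e l → i ℚ.* ((t ℚ.+ e ℚ.- ℚ.1ℚ) ℚ.* l) ≡ (i ℚ.* t) ℚ.* l ℚ.- (ℚ.1ℚ ℚ.- e) ℚ.* i ℚ.* l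
    expand = solve 4 (λ i t e l → i :* ((t :+ e :- con ℚ.1ℚ) :* l)
                                  := (i :* t) :* l :- (con ℚ.1ℚ :- e) :* i :* l) refl
    collect : ∀ i e l → ℚ.1ℚ ℚ.* l ℚ.- (ℚ.1ℚ ℚ.- e) ℚ.* i ℚ.* l ≡ (ℚ.1ℚ ℚ.- (ℚ.1ℚ ℚ.- e) ℚ.* i) ℚ.* l
    collect = solve 3 (λ i e l → con ℚ.1ℚ :* l :- (con ℚ.1ℚ :- e) :* i :* l
                                 := (con ℚ.1ℚ :- (con ℚ.1ℚ :- e) :* i) :* l) refl
    L+tc≤[t+η]L : Lℚ ℚ.+ tℚ ℚ.* cℚ ℚ.≤ (tℚ ℚ.+ η) ℚ.* Lℚ
    L+tc≤[t+η]L = begin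
      Lℚ ℚ.+ tℚ ℚ.* cℚ       ≡⟨ cong (Lℚ ℚ.+_) (toℚ-* (suc t) c) ⟨
      Lℚ ℚ.+ toℚ (suc t * c) ≡⟨ toℚ-+ L (suc t * c) ⟨
      toℚ (L + suc t * c)    ≤⟨ toℚ-mono-≤ L+tc≤E ⟩
      toℚ E                  ≤⟨ E≤[t+η]L ⟩
      (tℚ ℚ.+ η) ℚ.* Lℚ      ∎
    tc≤[t+η-1]L : tℚ ℚ.* cℚ ℚ.≤ (tℚ ℚ.+ η ℚ.- ℚ.1ℚ) ℚ.* Lℚ
    tc≤[t+η-1]L = begin
      tℚ ℚ.* cℚ                  ≡⟨ cancel Lℚ (tℚ ℚ.* cℚ) ⟩
      Lℚ ℚ.+ tℚ ℚ.* cℚ ℚ.- Lℚ    ≤⟨ ℚ.+-monoˡ-≤ (ℚ.- Lℚ) L+tc≤[t+η]L ⟩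
      (tℚ ℚ.+ η) ℚ.* Lℚ ℚ.- Lℚ   ≡⟨ factor tℚ η Lℚ ⟩
      (tℚ ℚ.+ η ℚ.- ℚ.1ℚ) ℚ.* Lℚ ∎

lemma2p3 : (η : ℚ) → ℚ.0ℚ ℚ.< η → η ℚ.< ℚ.1ℚ →
           (s t : ℕ) → 2 ℕ.≤ s → s ℕ.≤ t →
           (N : ℕ) → 1 ℕ.≤ N →
           (A : List ℕ) → Unique A → All (InRange N) A →
           toℚ (Es N s A) ℚ.≤ (toℚ t ℚ.+ η) ℚ.* toℚ (length A ℕ.^ s) →
           toℚ (countHigh s t A)
             ℚ.≤ (ℚ.1ℚ ℚ.- (ℚ.1ℚ ℚ.- η) ℚ.* invℕ t) ℚ.* toℚ (length A ℕ.^ s)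
lemma2p3 _ _ _ s zero    2≤s s≤0 _ _ _ _    _     _   = contradiction (≤-trans 2≤s s≤0) λ ()
lemma2p3 η _ _ s (suc t) _   _   N _ A uniq A⊆[N] Es≤ =
  ℕ-bound⇒ℚ-bound η t (countHigh s (suc t) A) (length A ^ s) (Es N s A)
                  (length^s+t*countHigh≤Es s (suc t) uniq A⊆[N]) Es≤
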